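{- Let $F$ be a figure with an equilibrium function $eq$ and associated set $\mathcal{H}_F$ of height functions, and let $h\in\mathcal{H}_F$. Then $h$ is the maximum of $(\mathcal{H}_F,\le)$ if and only if for every forced component $U$ there exists a directed path in $G_h$ from $U_\infty$ to $U$. Likewise, $h$ is the minimum of $(\mathcal{H}_F,\le)$ if and only if for every forced component $U$ there exists a directed path in $G_h$ from $U$ to $U_\infty$.
   Context: Square grid $\Lambda$ with vertices $\mathbb{Z}^2$, unit edges, unit square cells coloured black/white as a checkerboard. A figure $F$ is a finite 4-connected union of cells. $H_\infty$ is the unbounded 8-connected component of $\mathbb{R}^2\setminus F$. Every vertex all of whose incident edges lie on the boundary of $F$ (two cells of $F$ meeting only at that corner) is replaced by two copies, each adjacent to the two neighbours lying on one of these cells. $G_F=(V_F,E_F)$: vertices are corners of cells of $F$ (after duplication), arcs are both orientations of each side of each cell of $F$; $E_b(F)$: arcs whose edge lies on the boundary of $F$; others interior. For $g:E_F\to\mathbb{Z}$ and a path $P$, $g(P)$ is the sum of $g$ over arcs of $P$; $D(h)(v,v')=h(v')-h(v)$. Spin: $sp(v,v')=1$ if moving from $v$ to $v'$ there is a white cell on the left, $-1$ otherwise. $Dis_F(C)$ for an elementary clockwise cycle: black minus white cells of $F$ enclosed. An equilibrium function is a skew-symmetric $eq:E_F\to\mathbb{Z}$ with $sp(C)+eq(C)=4Dis_F(C)$ for all elementary clockwise cycles $C$. $\mathbf{t}(a)=eq(a)-sp(a)+2$, $\mathbf{b}(a)=eq(a)-sp(a)-2$ for interior arcs, $\mathbf{t}(a)=\mathbf{b}(a)=eq(a)+sp(a)$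 on $E_b(F)$. Fix $w_0\in V_F$ on the boundary of $H_\infty$; $\mathcal{H}_F$ is the set of $h:V_F\to\mathbb{Z}$ with $h(w_0)=0$ and $D(h)(a)\in\{\mathbf{b}(a),\mathbf{t}(a)\}$ for all $a$, ordered pointwise. An elementary cycle $C$ is critical if $\mathbf{t}(C)=0$. Forced components are the classes of the equivalence relation on $V_F$ under which vertices lying on a common critical cycle are equivalent; $U_\infty$ is the forced component containing $w_0$. For $h\in\mathcal{H}_F$, $G_h$ is the directed graph on the forced components with an arc $(U,U')$ iff $U\ne U'$ and there is an arc $(v,v')\in E_F$ with $v\in U$, $v'\in U'$, $D(h)(v,v')=\mathbf{t}(v,v')$. -}

module Defs where

open import Data.Integer as ℤ using (ℤ; +_; _+_; _-_; _*_; -_; ∣_∣; _<_; _≤_)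
open import Data.Nat as ℕ using (ℕ)
open import Data.Bool using (Bool; true; false; if_then_else_; _∧_; not)
open import Data.Product using (Σ; _×_; _,_; proj₁; proj₂)
open import Data.Product.Properties using (≡-dec)
open import Data.Sum using (_⊎_)
open import Data.List using (List; []; _∷_; _++_; [_]; zip; map; foldr; length)
open import Data.List.Membership.Propositional using (_∈_)
import Data.List.Membership.DecPropositional as DecMem
open import Data.List.Relation.Unary.All using (All)
open import Data.List.Relation.Unary.Any using (Any)
open import Data.List.Relation.Unary.AllPairs using (AllPairs)
open import Data.List.Relation.Unary.Unique.Propositional using (Unique)
open import Relation.Binary.Construct.Closure.ReflexiveTransitive using (Star)
open import Relation.Binary.PropositionalEquality using (_≡_; _≢_)
open import Relation.Nullary using (¬_; does)

-- Grid conventions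
-- A point of the lattice Z^2.  A cell is named by its lower-left corner
-- (i , j); it is the unit square [i,i+1] x [j,j+1].

Point : Set
Point = ℤ × ℤ

Cell : Set
Cell = ℤ × ℤ

_≟ᶜ_ : (a b : Cell) → Relation.Nullary.Dec (a ≡ b)
_≟ᶜ_ = ≡-dec ℤ._≟_ ℤ._≟_

open DecMem _≟ᶜ_ using (_∈?_)

isBlack : Cell → Bool
isBlack (i , j) = ∣ i + j ∣ ℕ.% 2 ℕ.≡ᵇ 0

-- lattice distance 1 (for points: a unit edge; for cells: sharing a side)
Unit : ℤ × ℤ → ℤ × ℤ → Set
Unit (a , b) (c , d) = ∣ a - c ∣ ℕ.+ ∣ b - d ∣ ≡ 1

Adj8 : Cell → Cell → Set
Adj8 (a , b) (c , d) = ((a , b) ≢ (c , d)) × (∣ a - c ∣ ℕ.≤ 1) × (∣ b - d ∣ ℕ.≤ 1)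

Corner : Point → Cell → Set
Corner (x , y) (i , j) = (x ≡ i ⊎ x ≡ i + + 1) × (y ≡ j ⊎ y ≡ j + + 1)

-- the cell on the left when moving along the unit edge from p to q
leftCell : Point → Point → Cell
leftCell (px , py) (qx , qy) =
  let dx = qx - px ; dy = qy - py in
  ( (if does (dy ℤ.≟ + 1) then px - + 1 else
     if does (dx ℤ.≟ - + 1) then px - + 1 else px)
  , (if does (dy ℤ.≟ - + 1) then py - + 1 else
     if does (dx ℤ.≟ - + 1) then py - + 1 else py) )

sp : Point → Point → ℤ
sp p q = if isBlack (leftCell p q) then - + 1 else + 1

ℤsum : List ℤ → ℤ
ℤsum = foldr _+_ (+ 0)

module _ (F : List Cell) where

  EdgeAdjIn : Cell → Cell → Set
  EdgeAdjIn c d = c ∈ F × d ∈ F × Unit c d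

  record IsFigure : Set where
    field
      nonEmpty  : F ≢ []
      distinct  : Unique F
      connected : ∀ {c d} → c ∈ F → d ∈ F → Star EdgeAdjIn c d

  -- cells of the unbounded 8-connected component H_∞ of the complement:
  -- cells not in F joined by an 8-path of non-F cells to a cell lying
  -- strictly to the right of every cell of F.
  Step8 : Cell → Cell → Set
  Step8 c d = ¬ (c ∈ F) × ¬ (d ∈ F) × Adj8 c d

  FarRight : Cell → Set
  FarRight (i , j) = All (λ c → proj₁ c < i) F

  InHinf : Cell → Set
  InHinf c = ¬ (c ∈ F) × Σ Cell (λ d → FarRight d × Star Step8 c d)

  -- A vertex is represented by a
  -- pair (p , c) with c a cell of F having p as a corner; two such pairs
  -- denote the same vertex iff they have the same point and the cells are
  -- joined by side-adjacent cells of F around p.  (This realises exactly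
  -- the duplication of points where only two diagonal cells of F meet.)

  V : Set
  V = Point × Cell

  pt : V → Point
  pt = proj₁

  Valid : V → Set
  Valid (p , c) = c ∈ F × Corner p c

  AroundStep : Point → Cell → Cell → Set
  AroundStep p c d = c ∈ F × d ∈ F × Corner p c × Corner p d × Unit c d

  _≈V_ : V → V → Set
  (p , c) ≈V (q , d) = p ≡ q × Valid (p , c) × Star (AroundStep p) c d

  -- arc of G_F from v to v' (the unit segment pq is a side of a cell d of F
  -- and d realises both endpoint copies)
  Arc : V → V → Set
  Arc (p , c) (q , c') =
    Σ Cell (λ d → d ∈ F × Corner p d × Corner q d × Unit p q
                 × (p , d) ≈V (p , c) × (q , d) ≈V (q , c'))

  isBoundary : Point → Point → Bool
  isBoundary p q = not (does (leftCell p q ∈? F) ∧ does (leftCell q p ∈? F))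

  -- Cycles: a cycle is a list of vertices v₀ … v_{n-1}, closed up by the
  -- arc v_{n-1} → v₀.

  steps : List V → List (V × V)
  steps []       = []
  steps (x ∷ xs) = zip (x ∷ xs) (xs ++ [ x ])

  cycSum : (Point → Point → ℤ) → List V → ℤ
  cycSum g C = ℤsum (map (λ s → g (pt (proj₁ s)) (pt (proj₂ s))) (steps C))

  Elementary : List V → Set
  Elementary C = (3 ℕ.≤ length C)
               × All (λ s → Arc (proj₁ s) (proj₂ s)) (steps C)
               × AllPairs (λ v v' → ¬ (v ≈V v')) C

  -- twice the signed area (shoelace); negative = clockwise
  shoelace : Point → Point → ℤ
  shoelace (px , py) (qx , qy) = px * qy - qx * py

  Clockwise : List V → Set
  Clockwise C = cycSum shoelace C < + 0

  -- winding number of the cycle around the centre of cell (i , j):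
  -- signed crossings of the horizontal ray to the right of the centre
  windStep : Cell → Point → Point → ℤ
  windStep (i , j) (px , py) (qx , qy) =
    if does (px ℤ.≟ qx) ∧ does (i ℤ.<? px)
    then (if does (py ℤ.≟ j) ∧ does (qy ℤ.≟ j + + 1) then + 1 else
          if does (py ℤ.≟ j + + 1) ∧ does (qy ℤ.≟ j) then - + 1 else + 0)
    else + 0

  wind : List V → Cell → ℤ
  wind C c = cycSum (windStep c) C

  Dis : List V → ℤ
  Dis C = ℤsum (map (λ c → if does (wind C c ℤ.≟ + 0) then + 0
                           else (if isBlack c then + 1 else - + 1)) F)

  OnCycle : V → List V → Set
  OnCycle v C = Any (v ≈V_) C

  OnBoundaryHinf : V → Set
  OnBoundaryHinf (p , c) = Valid (p , c) × Σ Cell (λ e → InHinf e × Corner p e)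

  -- Equilibrium functions (functions on arcs, indexed by the ordered pair
  -- of endpoints, which determines the arc).

  record IsEquilibrium (eq : Point → Point → ℤ) : Set where
    field
      skew    : ∀ v v' → Arc v v' → eq (pt v) (pt v') ≡ - eq (pt v') (pt v)
      balance : ∀ C → Elementary C → Clockwise C →
                cycSum sp C + cycSum eq C ≡ + 4 * Dis C

  module _ (eq : Point → Point → ℤ) where

    tt : Point → Point → ℤ
    tt p q = if isBoundary p q then eq p q + sp p q else eq p q - sp p q + + 2

    bb : Point → Point → ℤ
    bb p q = if isBoundary p q then eq p q + sp p q else eq p q - sp p q - + 2

    record HeightFn (w₀ : V) (h : V → ℤ) : Set where
      field
        wellDef : ∀ v v' → v ≈V v' → h v ≡ h v'
        base    : h w₀ ≡ + 0
        arcs    : ∀ v v' → Arc v v' →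
                  (h v' - h v ≡ bb (pt v) (pt v')) ⊎ (h v' - h v ≡ tt (pt v) (pt v'))

    IsMax : V → (V → ℤ) → Set
    IsMax w₀ h = ∀ h' → HeightFn w₀ h' → ∀ v → Valid v → h' v ≤ h v

    IsMin : V → (V → ℤ) → Set
    IsMin w₀ h = ∀ h' → HeightFn w₀ h' → ∀ v → Valid v → h v ≤ h' v

    Critical : List V → Set
    Critical C = Elementary C × cycSum tt C ≡ + 0

    CoCritical : V → V → Set
    CoCritical v v' = Σ (List V) (λ C → Critical C × OnCycle v C × OnCycle v' C)

    Forced : V → V → Set
    Forced = Star (λ v v' → CoCritical v v' ⊎ v ≈V v')

    -- an arc of G_h, seen on representatives: a tight arc between
    -- different forced components
    TightStep : (V → ℤ) → V → V → Set
    TightStep h v v' = Arc v v' × ¬ Forced v v' × (h v' - h v ≡ tt (pt v) (pt v'))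

    -- a directed walk in G_h from the component of v to that of v'
    GPath : (V → ℤ) → V → V → Set
    GPath h = Star (λ x y → Forced x y ⊎ TightStep h x y)

-- If h′ is any other height function, δ = h′ − h is constant on forced
-- components (critical cycles are tight for every height function) and does not
-- increase along a tight arc of h.  Hence paths in G_h from U_∞, where δ = 0,
-- give h′ ≤ h everywhere, and paths to U_∞ give h ≤ h′.  Conversely, if some
-- vertex is not reachable from U_∞, raising every unreachable vertex by 4 yields
-- another height function, because every arc entering that set is slack and
-- interior; dually for the minimum.  Reachability in G_h is decidable since a
-- figure is finite: forced components are found by enumerating all vertex lists
-- no longer than the number of vertices, which contain every elementary cycle.

module Submission where

open import Defs
open import Data.Bool using (Bool; true; false; not; if_then_else_)
open import Data.Bool.Properties using (not-involutive; ∧-comm)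
open import Data.Empty using (⊥-elim)
open import Data.Integer as ℤ using (ℤ; +_; -[1+_]; _+_; _-_; -_; ∣_∣; _≤_; +≤+)
import Data.Integer.Properties as ℤ
open import Data.Integer.Tactic.RingSolver using (solve-∀)
open import Data.List using (List; []; _∷_; _++_; [_]; length; map; zip; concatMap; cartesianProductWith)
open import Data.List.Properties using (length-++-sucʳ)
open import Data.List.Membership.Propositional using (_∈_; lose)
open import Data.List.Membership.Propositional.Properties
  using (∈-∃++; ∈-++⁻; ∈-++⁺ˡ; ∈-++⁺ʳ; ∈-map⁺; ∈-concatMap⁺; ∈-cartesianProductWith⁺)
open import Data.List.Relation.Binary.Subset.Propositional using (_⊆_)
open import Data.List.Relation.Unary.All as All using (All; []; _∷_; all?)
import Data.List.Relation.Unary.All.Properties as All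
open import Data.List.Relation.Unary.Any using (here; there; any?; satisfied)
open import Data.List.Relation.Unary.AllPairs using (AllPairs; []; _∷_; allPairs?)
open import Data.List.Relation.Unary.Unique.Propositional using (Unique)
open import Data.Nat as ℕ using (ℕ; zero; suc; z≤n; s≤s)
import Data.Nat.Properties as ℕ
open import Data.Product using (∃; _×_; _,_; proj₁; proj₂)
open import Data.Product.Properties using (≡-dec)
open import Data.Sum using (_⊎_; inj₁; inj₂; [_,_]′)
open import Function using (_∘_; flip; id)
open import Function.Bundles using (_⇔_; mk⇔)
open import Relation.Binary.Construct.Closure.ReflexiveTransitive using (Star; ε; _◅_; _◅◅_; reverse)
open import Relation.Binary.Definitions using (Decidable; DecidableEquality)
open import Relation.Binary.PropositionalEquality
  using (_≡_; _≢_; refl; sym; trans; cong; cong₂; subst; module ≡-Reasoning)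
open import Relation.Nullary using (Dec; does; ¬_)
open import Relation.Nullary.Decidable
  using (map′; _×-dec_; _⊎-dec_; ¬?; dec-true; dec-false; decidable-stable; toSum)

-- Reachability in a finite graph

module _ {A : Set} (R : A → A → Set) where

  data Walk (L : List A) : A → A → Set where
    edge : ∀ {x y} → R x y → Walk L x y
    via  : ∀ {x z y} → Walk L x z → z ∈ L → Walk L z y → Walk L x y

  Walk-weaken : ∀ {z L x y} → Walk L x y → Walk (z ∷ L) x y
  Walk-weaken (edge r)      = edge r
  Walk-weaken (via p z∈L q) = via (Walk-weaken p) (there z∈L) (Walk-weaken q)

  -- Floyd–Warshall: a walk through z ∷ L either avoids z or, cut at its
  -- first and last visit to z, yields two walks through L.
  Walk-split : ∀ {z L x y} → Walk (z ∷ L) x y → Walk L x y ⊎ (Walk L x z × Walk L z y)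
  Walk-split (edge r) = inj₁ (edge r)
  Walk-split (via p (here refl) q) = inj₂ ([ id , proj₁ ]′ (Walk-split p) , [ id , proj₂ ]′ (Walk-split q))
  Walk-split (via p (there a∈L) q) with Walk-split p | Walk-split q
  ... | inj₁ p′         | inj₁ q′         = inj₁ (via p′ a∈L q′)
  ... | inj₁ p′         | inj₂ (q₁ , q₂) = inj₂ (via p′ a∈L q₁ , q₂)
  ... | inj₂ (p₁ , p₂) | inj₁ q′         = inj₂ (p₁ , via p₂ a∈L q′)
  ... | inj₂ (p₁ , _)  | inj₂ (_ , q₂)  = inj₂ (p₁ , q₂)

  Walk-join : ∀ {z L x y} → Walk L x y ⊎ (Walk L x z × Walk L z y) → Walk (z ∷ L) x y
  Walk-join (inj₁ p)       = Walk-weaken p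
  Walk-join (inj₂ (p , q)) = via (Walk-weaken p) (here refl) (Walk-weaken q)

  Walk[]⇒edge : ∀ {x y} → Walk [] x y → R x y
  Walk[]⇒edge (edge r) = r

  Walk? : Decidable R → ∀ L → Decidable (Walk L)
  Walk? R? []      x y = map′ edge Walk[]⇒edge (R? x y)
  Walk? R? (z ∷ L) x y =
    map′ Walk-join Walk-split (Walk? R? L x y ⊎-dec (Walk? R? L x z ×-dec Walk? R? L z y))

  Walk⇒Star : ∀ {L x y} → Walk L x y → Star R x y
  Walk⇒Star (edge r)    = r ◅ ε
  Walk⇒Star (via p _ q) = Walk⇒Star p ◅◅ Walk⇒Star q

  module _ {L : List A} (closed : ∀ {a b} → a ∈ L → R a b → b ∈ L) where

    Star⇒Walk : ∀ {x y} → x ∈ L → Star R x y → x ≡ y ⊎ Walk L x y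
    Star⇒Walk x∈L ε = inj₁ refl
    Star⇒Walk x∈L (r ◅ rs) with Star⇒Walk (closed x∈L r) rs
    ... | inj₁ refl = inj₂ (edge r)
    ... | inj₂ p    = inj₂ (via (edge r) (closed x∈L r) p)

    Star? : DecidableEquality A → Decidable R → ∀ {x} → x ∈ L → ∀ y → Dec (Star R x y)
    Star? _≟_ R? {x} x∈L y =
      map′ [ (λ { refl → ε }) , Walk⇒Star ]′ (Star⇒Walk x∈L) ((x ≟ y) ⊎-dec Walk? R? L x y)

∃? : {A : Set} {P : A → Set} (xs : List A) → (∀ {a} → P a → a ∈ xs) →
     (∀ a → Dec (P a)) → Dec (∃ P)
∃? xs P⇒∈ P? = map′ satisfied (λ (a , pa) → lose (P⇒∈ pa) pa) (any? P? xs)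

Unique-⊆⇒length≤ : {A : Set} {xs ys : List A} → Unique xs → xs ⊆ ys → length xs ℕ.≤ length ys
Unique-⊆⇒length≤ {xs = []} _ _ = z≤n
Unique-⊆⇒length≤ {xs = x ∷ xs} (x∉xs ∷ unique) xs⊆ys with ∈-∃++ (xs⊆ys (here refl))
... | us , ws , refl =
  subst (suc (length xs) ℕ.≤_) (sym (length-++-sucʳ us x ws))
        (s≤s (Unique-⊆⇒length≤ unique xs⊆us++ws))
  where
  xs⊆us++ws : xs ⊆ us ++ ws
  xs⊆us++ws z∈xs with ∈-++⁻ us (xs⊆ys (there z∈xs))
  ... | inj₁ z∈us         = ∈-++⁺ˡ z∈us
  ... | inj₂ (here refl)  = ⊥-elim (All.lookup x∉xs z∈xs refl)
  ... | inj₂ (there z∈ws) = ∈-++⁺ʳ us z∈ws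

listsUpTo : {A : Set} → List A → ℕ → List (List A)
listsUpTo xs zero    = [ [] ]
listsUpTo xs (suc n) = [] ∷ cartesianProductWith _∷_ xs (listsUpTo xs n)

∈-listsUpTo : {A : Set} {xs ys : List A} (n : ℕ) → ys ⊆ xs → length ys ℕ.≤ n → ys ∈ listsUpTo xs n
∈-listsUpTo {ys = []}     zero    _     _         = here refl
∈-listsUpTo {ys = []}     (suc n) _     _         = here refl
∈-listsUpTo {ys = y ∷ ys} (suc n) ys⊆xs (s≤s len) =
  there (∈-cartesianProductWith⁺ _∷_ (ys⊆xs (here refl)) (∈-listsUpTo n (ys⊆xs ∘ there) len))

-- Integer sums and increments

ℤsum-nonneg : ∀ {xs} → All (+ 0 ≤_) xs → + 0 ≤ ℤsum xs
ℤsum-nonneg []       = ℤ.≤-refl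
ℤsum-nonneg (p ∷ ps) = ℤ.+-mono-≤ p (ℤsum-nonneg ps)

ℤsum-nonneg-zero : ∀ {xs} → All (+ 0 ≤_) xs → ℤsum xs ≡ + 0 → All (_≡ + 0) xs
ℤsum-nonneg-zero []                _     = []
ℤsum-nonneg-zero {x ∷ xs} (p ∷ ps) sum≡0 = x≡0 ∷ ℤsum-nonneg-zero ps rest≡0
  where
  x≤sum : x ≤ ℤsum (x ∷ xs)
  x≤sum = subst (_≤ ℤsum (x ∷ xs)) (ℤ.+-identityʳ x) (ℤ.+-monoʳ-≤ x (ℤsum-nonneg ps))
  x≡0 : x ≡ + 0
  x≡0 = ℤ.≤-antisym (subst (x ≤_) sum≡0 x≤sum) p
  rest≡0 : ℤsum xs ≡ + 0
  rest≡0 = trans (sym (ℤ.+-identityˡ _)) (trans (cong (_+ ℤsum xs) (sym x≡0)) sum≡0)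

ℤsum-map-minus : {X : Set} (f g : X → ℤ) (xs : List X) →
                 ℤsum (map (λ s → f s - g s) xs) ≡ ℤsum (map f xs) - ℤsum (map g xs)
ℤsum-map-minus f g []       = refl
ℤsum-map-minus f g (x ∷ xs) rewrite ℤsum-map-minus f g xs = interchange (f x) (g x) _ _
  where
  interchange : ∀ a b c d → (a - b) + (c - d) ≡ (a + c) - (b + d)
  interchange = solve-∀

ℤsum-telescope : {X : Set} (k : X → ℤ) (x : X) (xs : List X) (y : X) →
                 ℤsum (map (λ s → k (proj₂ s) - k (proj₁ s)) (zip (x ∷ xs) (xs ++ [ y ]))) ≡ k y - k x
ℤsum-telescope k x []       y = ℤ.+-identityʳ _
ℤsum-telescope k x (z ∷ zs) y rewrite ℤsum-telescope k z zs y = telescope (k x) (k z) (k y)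
  where
  telescope : ∀ a b c → (b - a) + (c - b) ≡ c - a
  telescope = solve-∀

All-proj₁-zip : {X : Set} {P : X → Set} (x : X) (xs : List X) (y : X) →
                All (P ∘ proj₁) (zip (x ∷ xs) (xs ++ [ y ])) → All P (x ∷ xs)
All-proj₁-zip x []       y (px ∷ _)   = px ∷ []
All-proj₁-zip x (z ∷ zs) y (px ∷ pzs) = px ∷ All-proj₁-zip z zs y pzs

constant-along-zip : {X : Set} (f : X → ℤ) (x : X) (xs : List X) (y : X) →
                     All (λ s → f (proj₁ s) ≡ f (proj₂ s)) (zip (x ∷ xs) (xs ++ [ y ])) →
                     All (λ z → f z ≡ f x) (x ∷ xs)
constant-along-zip f x []       y _           = refl ∷ []
constant-along-zip f x (z ∷ zs) y (fx≡fz ∷ es) =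
  refl ∷ All.map (λ fu≡fz → trans fu≡fz (sym fx≡fz)) (constant-along-zip f z zs y es)

i+j≤i⇒j≤0 : ∀ i j → i + j ≤ i → j ≤ + 0
i+j≤i⇒j≤0 i j i+j≤i = subst (_≤ + 0) (cancel i j) (ℤ.i≤j⇒i-j≤0 i+j≤i)
  where
  cancel : ∀ i j → (i + j) - i ≡ j
  cancel = solve-∀

i≤i+j⇒0≤j : ∀ i j → i ≤ i + j → + 0 ≤ j
i≤i+j⇒0≤j i j i≤i+j = subst (+ 0 ≤_) (cancel i j) (ℤ.i≤j⇒0≤j-i i≤i+j)
  where
  cancel : ∀ i j → (i + j) - i ≡ j
  cancel = solve-∀

increments-equal : ∀ x x′ y y′ → y - x ≡ y′ - x′ → x′ - x ≡ y′ - y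
increments-equal x x′ y y′ e = begin
  x′ - x                             ≡⟨ rearrange x x′ y y′ ⟩
  (y′ - y) + ((y - x) - (y′ - x′))   ≡⟨ cong (λ d → (y′ - y) + (d - (y′ - x′))) e ⟩
  (y′ - y) + ((y′ - x′) - (y′ - x′)) ≡⟨ cong (_+_ (y′ - y)) (ℤ.+-inverseʳ (y′ - x′)) ⟩
  (y′ - y) + + 0                     ≡⟨ ℤ.+-identityʳ _ ⟩
  y′ - y                             ∎
  where
  open ≡-Reasoning
  rearrange : ∀ x x′ y y′ → x′ - x ≡ (y′ - y) + ((y - x) - (y′ - x′))
  rearrange = solve-∀

increments-≤ : ∀ x x′ y y′ → y′ - x′ ≤ y - x → y′ - y ≤ x′ - x
increments-≤ x x′ y y′ le = ℤ.0≤i-j⇒j≤i (subst (+ 0 ≤_) (rearrange x x′ y y′) (ℤ.i≤j⇒0≤j-i le))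
  where
  rearrange : ∀ x x′ y y′ → (y - x) - (y′ - x′) ≡ (x′ - x) - (y′ - y)
  rearrange = solve-∀

-- Lattice geometry

even : ℤ → Bool
even n = ∣ n ∣ ℕ.% 2 ℕ.≡ᵇ 0

evenℕ-suc : ∀ m → (suc m ℕ.% 2 ℕ.≡ᵇ 0) ≡ not (m ℕ.% 2 ℕ.≡ᵇ 0)
evenℕ-suc zero          = refl
evenℕ-suc (suc zero)    = refl
evenℕ-suc (suc (suc m)) = evenℕ-suc m

even-pred : ∀ n → even (n - + 1) ≡ not (even n)
even-pred (+ zero)  = refl
even-pred (+ suc m) = trans (sym (not-involutive _)) (cong not (sym (evenℕ-suc m)))
even-pred -[1+ m ] rewrite ℕ.+-identityʳ m =
  trans (sym (not-involutive _)) (cong not (sym (evenℕ-suc m)))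

spin : Bool → ℤ
spin b = if b then - + 1 else + 1

spin-not : ∀ b → spin (not b) ≡ - spin b
spin-not true  = refl
spin-not false = refl

spin-adjacent : ∀ i j k l → k + l ≡ (i + j) - + 1 → spin (isBlack (k , l)) ≡ - spin (isBlack (i , j))
spin-adjacent i j k l e = trans (cong spin (trans (cong even e) (even-pred (i + j)))) (spin-not _)

[a+1]-a≡1 : ∀ a → (a + + 1) - a ≡ + 1
[a+1]-a≡1 = solve-∀

a-[a+1]≡-1 : ∀ a → a - (a + + 1) ≡ - + 1
a-[a+1]≡-1 = solve-∀

-- Once the offsets q − p are literals, leftCell p q and leftCell q p compute.
sp-east : ∀ a b → sp (a + + 1 , b) (a , b) ≡ - sp (a , b) (a + + 1 , b)
sp-east a b rewrite [a+1]-a≡1 a | a-[a+1]≡-1 a | ℤ.+-inverseʳ b =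
  spin-adjacent a b ((a + + 1) - + 1) (b - + 1) (cell-sums a b)
  where
  cell-sums : ∀ a b → ((a + + 1) - + 1) + (b - + 1) ≡ (a + b) - + 1
  cell-sums = solve-∀

sp-north : ∀ a b → sp (a , b + + 1) (a , b) ≡ - sp (a , b) (a , b + + 1)
sp-north a b rewrite [a+1]-a≡1 b | a-[a+1]≡-1 b | ℤ.+-inverseʳ a = begin
  spin (isBlack (a , (b + + 1) - + 1))       ≡⟨ ℤ.neg-involutive _ ⟨
  - - spin (isBlack (a , (b + + 1) - + 1))   ≡⟨ cong -_ (spin-adjacent a _ (a - + 1) b (cell-sums a b)) ⟨
  - spin (isBlack (a - + 1 , b))             ∎
  where
  open ≡-Reasoning
  cell-sums : ∀ a b → (a - + 1) + b ≡ (a + ((b + + 1) - + 1)) - + 1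
  cell-sums = solve-∀

∣i-j∣≡1⇒adjacent : ∀ i j → ∣ i - j ∣ ≡ 1 → i ≡ j + + 1 ⊎ j ≡ i + + 1
∣i-j∣≡1⇒adjacent i j ∣i-j∣≡1 with i - j in i-j≡
... | + 1      = inj₁ (trans (i≡j+[i-j] i j) (cong (_+_ j) i-j≡))
  where
  i≡j+[i-j] : ∀ i j → i ≡ j + (i - j)
  i≡j+[i-j] = solve-∀
... | -[1+ 0 ] = inj₂ (trans (j≡i-[i-j] i j) (cong (λ d → i - d) i-j≡))
  where
  j≡i-[i-j] : ∀ i j → j ≡ i - (i - j)
  j≡i-[i-j] = solve-∀

∣i-j∣≡0⇒i≡j : ∀ i j → ∣ i - j ∣ ≡ 0 → i ≡ j
∣i-j∣≡0⇒i≡j i j = ℤ.i-j≡0⇒i≡j i j ∘ ℤ.∣i∣≡0⇒i≡0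

Unit⇒adjacent : ∀ {a b c d} → Unit (a , b) (c , d) →
  (c ≡ a + + 1 × d ≡ b) ⊎ (a ≡ c + + 1 × b ≡ d) ⊎ (d ≡ b + + 1 × c ≡ a) ⊎ (b ≡ d + + 1 × a ≡ c)
Unit⇒adjacent {a} {b} {c} {d} u with ∣ a - c ∣ in ∣a-c∣≡ | ∣ b - d ∣ in ∣b-d∣≡
... | 0 | 1 with ∣i-j∣≡1⇒adjacent b d ∣b-d∣≡
...   | inj₁ b≡d+1 = inj₂ (inj₂ (inj₂ (b≡d+1 , ∣i-j∣≡0⇒i≡j a c ∣a-c∣≡)))
...   | inj₂ d≡b+1 = inj₂ (inj₂ (inj₁ (d≡b+1 , sym (∣i-j∣≡0⇒i≡j a c ∣a-c∣≡))))
Unit⇒adjacent {a} {b} {c} {d} u | 1 | 0 with ∣i-j∣≡1⇒adjacent a c ∣a-c∣≡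
...   | inj₁ a≡c+1 = inj₂ (inj₁ (a≡c+1 , ∣i-j∣≡0⇒i≡j b d ∣b-d∣≡))
...   | inj₂ c≡a+1 = inj₁ (c≡a+1 , sym (∣i-j∣≡0⇒i≡j b d ∣b-d∣≡))

i≡-j⇒j≡-i : ∀ {i j} → i ≡ - j → j ≡ - i
i≡-j⇒j≡-i {i} {j} i≡-j = trans (sym (ℤ.neg-involutive j)) (cong -_ (sym i≡-j))

sp-antisym : ∀ p q → Unit p q → sp q p ≡ - sp p q
sp-antisym (a , b) (c , d) u with Unit⇒adjacent {a} {b} {c} {d} u
... | inj₁ (refl , refl)               = sp-east a b
... | inj₂ (inj₁ (refl , refl))        = i≡-j⇒j≡-i (sp-east c d)
... | inj₂ (inj₂ (inj₁ (refl , refl))) = sp-north a b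
... | inj₂ (inj₂ (inj₂ (refl , refl))) = i≡-j⇒j≡-i (sp-north c d)

Unit-sym : ∀ p q → Unit p q → Unit q p
Unit-sym (a , b) (c , d) u rewrite ℤ.∣i-j∣≡∣j-i∣ c a | ℤ.∣i-j∣≡∣j-i∣ d b = u

_≟ᵖ_ : DecidableEquality Point
_≟ᵖ_ = ≡-dec ℤ._≟_ ℤ._≟_

Corner? : ∀ p c → Dec (Corner p c)
Corner? (x , y) (i , j) = (x ℤ.≟ i ⊎-dec x ℤ.≟ i + + 1) ×-dec (y ℤ.≟ j ⊎-dec y ℤ.≟ j + + 1)

Unit? : ∀ p q → Dec (Unit p q)
Unit? (a , b) (c , d) = (∣ a - c ∣ ℕ.+ ∣ b - d ∣) ℕ.≟ 1

corners : Cell → List Point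
corners (i , j) = (i , j) ∷ (i + + 1 , j) ∷ (i , j + + 1) ∷ (i + + 1 , j + + 1) ∷ []

Corner⇒∈corners : ∀ {p c} → Corner p c → p ∈ corners c
Corner⇒∈corners (inj₁ refl , inj₁ refl) = here refl
Corner⇒∈corners (inj₂ refl , inj₁ refl) = there (here refl)
Corner⇒∈corners (inj₁ refl , inj₂ refl) = there (there (here refl))
Corner⇒∈corners (inj₂ refl , inj₂ refl) = there (there (there (here refl)))

-- Finiteness of a figure: the predicates of G_F are decidable

module Figure (F : List Cell) where

  open import Data.List.Membership.DecPropositional _≟ᶜ_ using (_∈?_)

  _≟ᵛ_ : DecidableEquality (V F)
  _≟ᵛ_ = ≡-dec _≟ᵖ_ _≟ᶜ_

  vertices : List (V F)
  vertices = concatMap (λ c → map (_, c) (corners c)) F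

  Valid⇒∈vertices : ∀ {v} → Valid F v → v ∈ vertices
  Valid⇒∈vertices {p , c} (c∈F , corner) =
    ∈-concatMap⁺ (λ c → map (_, c) (corners c)) (lose c∈F (∈-map⁺ (_, c) (Corner⇒∈corners corner)))

  Valid? : ∀ v → Dec (Valid F v)
  Valid? (p , c) = c ∈? F ×-dec Corner? p c

  AroundStep? : ∀ p c d → Dec (AroundStep F p c d)
  AroundStep? p c d = c ∈? F ×-dec d ∈? F ×-dec Corner? p c ×-dec Corner? p d ×-dec Unit? c d

  _≈?_ : Decidable (_≈V_ F)
  (p , c) ≈? (q , d) =
    p ≟ᵖ q ×-dec Valid? (p , c) ×-dec
    Star? (AroundStep F p) (λ _ step → there (proj₁ (proj₂ step))) _≟ᶜ_ (AroundStep? p) (here refl) d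

  Star-AroundStep-Valid : ∀ {p c d} → Valid F (p , c) → Star (AroundStep F p) c d → Valid F (p , d)
  Star-AroundStep-Valid valid ε = valid
  Star-AroundStep-Valid _ ((_ , d∈F , _ , corner , _) ◅ steps) = Star-AroundStep-Valid (d∈F , corner) steps

  ≈-Valid₁ : ∀ {v w} → _≈V_ F v w → Valid F v
  ≈-Valid₁ {p , c} {q , d} (_ , valid , _) = valid

  ≈-Valid₂ : ∀ {v w} → _≈V_ F v w → Valid F w
  ≈-Valid₂ {p , c} {q , d} (refl , valid , steps) = Star-AroundStep-Valid valid steps

  ≈-refl : ∀ {v} → Valid F v → _≈V_ F v v
  ≈-refl {p , c} valid = refl , valid , ε

  ≈-sym : ∀ {v w} → _≈V_ F v w → _≈V_ F w v
  ≈-sym {p , c} {q , d} e@(refl , _ , steps) = refl , ≈-Valid₂ e , reverse AroundStep-sym steps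
    where
    AroundStep-sym : ∀ {a b} → AroundStep F p a b → AroundStep F p b a
    AroundStep-sym {a} {b} (a∈F , b∈F , ca , cb , u) = b∈F , a∈F , cb , ca , Unit-sym a b u

  isBoundary-sym : ∀ p q → isBoundary F p q ≡ isBoundary F q p
  isBoundary-sym p q = cong not (∧-comm (does (leftCell p q ∈? F)) (does (leftCell q p ∈? F)))

  Arc? : Decidable (Arc F)
  Arc? (p , c) (q , c′) = ∃? F proj₁ λ d →
    d ∈? F ×-dec Corner? p d ×-dec Corner? q d ×-dec Unit? p q ×-dec
    (p , d) ≈? (p , c) ×-dec (q , d) ≈? (q , c′)

  Arc-Valid₁ : ∀ {v w} → Arc F v w → Valid F v
  Arc-Valid₁ {p , c} {q , c′} (_ , _ , _ , _ , _ , e , _) = ≈-Valid₂ e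

  Arc-Valid₂ : ∀ {v w} → Arc F v w → Valid F w
  Arc-Valid₂ {p , c} {q , c′} (_ , _ , _ , _ , _ , _ , e) = ≈-Valid₂ e

  Arc-reverse : ∀ {v w} → Arc F v w → Arc F w v
  Arc-reverse {p , c} {q , c′} (d , d∈F , cp , cq , u , e , e′) = d , d∈F , cq , cp , Unit-sym p q u , e′ , e

  Arc⇒Unit : ∀ {v w} → Arc F v w → Unit (pt F v) (pt F w)
  Arc⇒Unit {p , c} {q , c′} (_ , _ , _ , _ , u , _) = u

  Elementary? : ∀ C → Dec (Elementary F C)
  Elementary? C =
    3 ℕ.≤? length C ×-dec all? (λ (v , w) → Arc? v w) (steps F C) ×-dec allPairs? (λ v w → ¬? (v ≈? w)) C

  Elementary⇒All-Valid : ∀ {C} → Elementary F C → All (Valid F) C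
  Elementary⇒All-Valid {[]}     _              = []
  Elementary⇒All-Valid {x ∷ xs} (_ , arcs , _) = All-proj₁-zip x xs x (All.map Arc-Valid₁ arcs)

  Elementary⇒Unique : ∀ {C} → Elementary F C → Unique C
  Elementary⇒Unique {C} el@(_ , _ , distinct) = go (Elementary⇒All-Valid el) distinct
    where
    go : ∀ {D} → All (Valid F) D → AllPairs (λ v w → ¬ _≈V_ F v w) D → Unique D
    go []             []          = []
    go (valid ∷ vals) (v≉ ∷ v≉s) =
      All.map (λ v≉w v≡w → v≉w (subst (_≈V_ F _) v≡w (≈-refl valid))) v≉ ∷ go vals v≉s

  cycles : List (List (V F))
  cycles = listsUpTo vertices (length vertices)

  Elementary⇒∈cycles : ∀ {C} → Elementary F C → C ∈ cycles
  Elementary⇒∈cycles {C} el = ∈-listsUpTo (length vertices) C⊆vertices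
    (Unique-⊆⇒length≤ (Elementary⇒Unique el) C⊆vertices)
    where
    C⊆vertices : C ⊆ vertices
    C⊆vertices v∈C = Valid⇒∈vertices (All.lookup (Elementary⇒All-Valid el) v∈C)

-- Forced components and the graph G_h

module Equilibrium (F : List Cell) (eq : Point → Point → ℤ) where

  open Figure F

  Critical? : ∀ C → Dec (Critical F eq C)
  Critical? C = Elementary? C ×-dec cycSum F (tt F eq) C ℤ.≟ + 0

  OnCycle? : ∀ v C → Dec (OnCycle F v C)
  OnCycle? v C = any? (v ≈?_) C

  OnCycle⇒Valid : ∀ {v C} → OnCycle F v C → Valid F v
  OnCycle⇒Valid (here v≈w)   = ≈-Valid₁ v≈w
  OnCycle⇒Valid (there v∈C) = OnCycle⇒Valid v∈C

  CoCritical? : Decidable (CoCritical F eq)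
  CoCritical? v w = ∃? cycles (Elementary⇒∈cycles ∘ proj₁ ∘ proj₁) λ C →
    Critical? C ×-dec OnCycle? v C ×-dec OnCycle? w C

  ForcedStep : V F → V F → Set
  ForcedStep v w = CoCritical F eq v w ⊎ _≈V_ F v w

  ForcedStep-Valid₁ : ∀ {v w} → ForcedStep v w → Valid F v
  ForcedStep-Valid₁ (inj₁ (_ , _ , v∈C , _)) = OnCycle⇒Valid v∈C
  ForcedStep-Valid₁ (inj₂ v≈w)                = ≈-Valid₁ v≈w

  ForcedStep-Valid₂ : ∀ {v w} → ForcedStep v w → Valid F w
  ForcedStep-Valid₂ (inj₁ (_ , _ , _ , w∈C)) = OnCycle⇒Valid w∈C
  ForcedStep-Valid₂ (inj₂ v≈w)                = ≈-Valid₂ v≈w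

  Forced? : Decidable (Forced F eq)
  Forced? v w = Star? ForcedStep (λ _ step → there (Valid⇒∈vertices (ForcedStep-Valid₂ step)))
    _≟ᵛ_ (λ v w → CoCritical? v w ⊎-dec v ≈? w) (here refl) w

  Forced-∈ : ∀ {v w} → v ∈ vertices → Forced F eq v w → w ∈ vertices
  Forced-∈ v∈ ε              = v∈
  Forced-∈ _  (step ◅ steps) = Forced-∈ (Valid⇒∈vertices (ForcedStep-Valid₂ step)) steps

  Forced-∈⁻ : ∀ {v w} → w ∈ vertices → Forced F eq v w → v ∈ vertices
  Forced-∈⁻ w∈ ε         = w∈
  Forced-∈⁻ _  (step ◅ _) = Valid⇒∈vertices (ForcedStep-Valid₁ step)

  module _ (h : V F → ℤ) where

    GStep : V F → V F → Set
    GStep v w = Forced F eq v w ⊎ TightStep F eq h v w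

    GStep? : Decidable GStep
    GStep? v w = Forced? v w ⊎-dec
      Arc? v w ×-dec ¬? (Forced? v w) ×-dec h w - h v ℤ.≟ tt F eq (pt F v) (pt F w)

    GStep-∈ : ∀ {v w} → v ∈ vertices → GStep v w → w ∈ vertices
    GStep-∈ v∈ (inj₁ forced)    = Forced-∈ v∈ forced
    GStep-∈ _  (inj₂ (arc , _)) = Valid⇒∈vertices (Arc-Valid₂ arc)

    GStep-∈⁻ : ∀ {v w} → w ∈ vertices → GStep v w → v ∈ vertices
    GStep-∈⁻ w∈ (inj₁ forced)    = Forced-∈⁻ w∈ forced
    GStep-∈⁻ _  (inj₂ (arc , _)) = Valid⇒∈vertices (Arc-Valid₁ arc)

    GPath-from? : ∀ {w₀} → Valid F w₀ → ∀ u → Dec (GPath F eq h w₀ u)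
    GPath-from? w₀-valid = Star? GStep GStep-∈ _≟ᵛ_ GStep? (Valid⇒∈vertices w₀-valid)

    GPath-to? : ∀ {w₀} → Valid F w₀ → ∀ u → Dec (GPath F eq h u w₀)
    GPath-to? w₀-valid u = map′ (reverse id) (reverse id)
      (Star? (flip GStep) GStep-∈⁻ _≟ᵛ_ (flip GStep?) (Valid⇒∈vertices w₀-valid) u)

-- Height functions

module HeightFunctions (F : List Cell) (eq : Point → Point → ℤ) (isEq : IsEquilibrium F eq) where

  open Figure F
  open Equilibrium F eq

  bb≤tt : ∀ p q → bb F eq p q ≤ tt F eq p q
  bb≤tt p q with isBoundary F p q
  ... | true  = ℤ.≤-refl
  ... | false = ℤ.+-monoʳ-≤ (eq p q - sp p q) ℤ.-≤+

  tt≡bb⊎interior : ∀ p q → tt F eq p q ≡ bb F eq p q ⊎ isBoundary F p q ≡ false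
  tt≡bb⊎interior p q with isBoundary F p q
  ... | true  = inj₁ refl
  ... | false = inj₂ refl

  interior⇒tt≡bb+4 : ∀ {p q} → isBoundary F p q ≡ false → tt F eq p q ≡ bb F eq p q + + 4
  interior⇒tt≡bb+4 {p} {q} bd rewrite bd = shift (eq p q - sp p q)
    where
    shift : ∀ x → x + + 2 ≡ (x - + 2) + + 4
    shift = solve-∀

  tt≡-bb-reverse : ∀ {v w} → Arc F v w → tt F eq (pt F v) (pt F w) ≡ - bb F eq (pt F w) (pt F v)
  tt≡-bb-reverse {p , c} {q , c′} arc
    rewrite isBoundary-sym q p
          | IsEquilibrium.skew isEq (q , c′) (p , c) (Arc-reverse arc)
          | sp-antisym p q (Arc⇒Unit arc)
    with isBoundary F p q
  ... | true  = boundary-case (eq p q) (sp p q)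
    where
    boundary-case : ∀ e s → e + s ≡ - (- e + - s)
    boundary-case = solve-∀
  ... | false = interior-case (eq p q) (sp p q)
    where
    interior-case : ∀ e s → e - s + + 2 ≡ - (- e - - s - + 2)
    interior-case = solve-∀

  module _ {w₀ : V F} {k : V F → ℤ} (hk : HeightFn F eq w₀ k) where

    Arc⇒increment≤tt : ∀ {v w} → Arc F v w → k w - k v ≤ tt F eq (pt F v) (pt F w)
    Arc⇒increment≤tt {v} {w} arc with HeightFn.arcs hk v w arc
    ... | inj₁ low  = subst (_≤ tt F eq (pt F v) (pt F w)) (sym low) (bb≤tt (pt F v) (pt F w))
    ... | inj₂ high = ℤ.≤-reflexive high

    -- The slacks tt − Dk along C are nonnegative and sum to tt(C) − 0 = 0.
    Critical⇒tight : ∀ {C} → Critical F eq C →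
      All (λ s → k (proj₂ s) - k (proj₁ s) ≡ tt F eq (pt F (proj₁ s)) (pt F (proj₂ s))) (steps F C)
    Critical⇒tight {[]}     ((() , _) , _)
    Critical⇒tight {x ∷ xs} ((_ , arcs , _) , tt[C]≡0) =
      All.map (λ slack≡0 → sym (ℤ.i-j≡0⇒i≡j _ _ slack≡0))
              (All.map⁻ (ℤsum-nonneg-zero slacks-nonneg total-slack≡0))
      where
      open ≡-Reasoning
      St = steps F (x ∷ xs)
      increment : V F × V F → ℤ
      increment s = k (proj₂ s) - k (proj₁ s)
      slack : V F × V F → ℤ
      slack s = tt F eq (pt F (proj₁ s)) (pt F (proj₂ s)) - increment s
      slacks-nonneg : All (+ 0 ≤_) (map slack St)
      slacks-nonneg = All.map⁺ (All.map (ℤ.i≤j⇒0≤j-i ∘ Arc⇒increment≤tt) arcs)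
      total-slack≡0 : ℤsum (map slack St) ≡ + 0
      total-slack≡0 = begin
        ℤsum (map slack St)
          ≡⟨ ℤsum-map-minus _ increment St ⟩
        cycSum F (tt F eq) (x ∷ xs) - ℤsum (map increment St)
          ≡⟨ cong₂ _-_ tt[C]≡0 (ℤsum-telescope k x xs x) ⟩
        + 0 - (k x - k x)
          ≡⟨ cong (_-_ (+ 0)) (ℤ.+-inverseʳ (k x)) ⟩
        + 0
          ∎

  module Comparison {w₀ : V F} {h h′ : V F → ℤ}
                    (hf : HeightFn F eq w₀ h) (hf′ : HeightFn F eq w₀ h′) where

    δ : V F → ℤ
    δ v = h′ v - h v

    δ-w₀ : δ w₀ ≡ + 0
    δ-w₀ = cong₂ _-_ (HeightFn.base hf′) (HeightFn.base hf)

    δ-wellDef : ∀ {v w} → _≈V_ F v w → δ v ≡ δ w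
    δ-wellDef {v} {w} v≈w = cong₂ _-_ (HeightFn.wellDef hf′ v w v≈w) (HeightFn.wellDef hf v w v≈w)

    CoCritical⇒δ≡ : ∀ {v w} → CoCritical F eq v w → δ v ≡ δ w
    CoCritical⇒δ≡ ([] , ((() , _) , _) , _)
    CoCritical⇒δ≡ (x ∷ xs , critical , v∈C , w∈C) = trans (δ≡δx v∈C) (sym (δ≡δx w∈C))
      where
      δ-steps : All (λ s → δ (proj₁ s) ≡ δ (proj₂ s)) (steps F (x ∷ xs))
      δ-steps = All.map (λ {s} (tight , tight′) →
                          increments-equal (h (proj₁ s)) (h′ (proj₁ s)) (h (proj₂ s)) (h′ (proj₂ s))
                                           (trans tight (sym tight′)))
                        (All.zip (Critical⇒tight hf critical , Critical⇒tight hf′ critical))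
      δ≡δx : ∀ {u} → OnCycle F u (x ∷ xs) → δ u ≡ δ x
      δ≡δx u∈C with All.lookupAny (constant-along-zip δ x xs x δ-steps) u∈C
      ... | δc≡δx , u≈c = trans (δ-wellDef u≈c) δc≡δx

    Forced⇒δ≡ : ∀ {v w} → Forced F eq v w → δ v ≡ δ w
    Forced⇒δ≡ ε                       = refl
    Forced⇒δ≡ (inj₁ cocritical ◅ steps) = trans (CoCritical⇒δ≡ cocritical) (Forced⇒δ≡ steps)
    Forced⇒δ≡ (inj₂ v≈w ◅ steps)        = trans (δ-wellDef v≈w) (Forced⇒δ≡ steps)

    GStep⇒δ≤ : ∀ {v w} → GStep h v w → δ w ≤ δ v
    GStep⇒δ≤ (inj₁ forced) = ℤ.≤-reflexive (sym (Forced⇒δ≡ forced))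
    GStep⇒δ≤ {v} {w} (inj₂ (arc , _ , tight)) = increments-≤ (h v) (h′ v) (h w) (h′ w)
      (subst (h′ w - h′ v ≤_) (sym tight) (Arc⇒increment≤tt hf′ arc))

    GPath⇒δ≤ : ∀ {v w} → GPath F eq h v w → δ w ≤ δ v
    GPath⇒δ≤ ε              = ℤ.≤-refl
    GPath⇒δ≤ (step ◅ steps) = ℤ.≤-trans (GPath⇒δ≤ steps) (GStep⇒δ≤ step)

  module _ {w₀ : V F} {h : V F → ℤ} (hf : HeightFn F eq w₀ h) where

    paths-from⇒IsMax : (∀ u → Valid F u → GPath F eq h w₀ u) → IsMax F eq w₀ h
    paths-from⇒IsMax paths h′ hf′ u valid = ℤ.i-j≤0⇒i≤j (subst (δ u ≤_) δ-w₀ (GPath⇒δ≤ (paths u valid)))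
      where open Comparison hf hf′

    paths-to⇒IsMin : (∀ u → Valid F u → GPath F eq h u w₀) → IsMin F eq w₀ h
    paths-to⇒IsMin paths h′ hf′ u valid = ℤ.0≤i-j⇒j≤i (subst (_≤ δ u) δ-w₀ (GPath⇒δ≤ (paths u valid)))
      where open Comparison hf hf′

    -- Whether or not v and w are forced to each other, a tight arc is a G_h-step.
    ¬GStep⇒¬tight : ∀ {v w} → Arc F v w → ¬ GStep h v w → h w - h v ≢ tt F eq (pt F v) (pt F w)
    ¬GStep⇒¬tight arc ¬step tight = ¬step (inj₂ (arc , ¬step ∘ inj₁ , tight))

    ¬GStep⇒slack : ∀ {v w} → Arc F v w → ¬ GStep h v w →
                   h w - h v ≡ bb F eq (pt F v) (pt F w) × isBoundary F (pt F v) (pt F w) ≡ false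
    ¬GStep⇒slack {v} {w} arc ¬step with HeightFn.arcs hf v w arc
    ... | inj₂ tight = ⊥-elim (¬GStep⇒¬tight arc ¬step tight)
    ... | inj₁ low   = low , [ (λ tt≡bb → ⊥-elim (¬GStep⇒¬tight arc ¬step (trans low (sym tt≡bb)))) , id ]′
                               (tt≡bb⊎interior (pt F v) (pt F w))

    -- Raising the vertices of a predecessor-closed set P of G_h by 4 keeps every
    -- arc admissible: an arc entering P is not a G_h-step, so it is slack and
    -- interior and gains exactly tt − bb = 4; an arc leaving P is the reverse of
    -- such an arc, hence tight, and loses 4.
    module Offset {P : V F → Set} (P? : ∀ v → Dec (P v)) (c : ℤ)
                  (closed : ∀ {v w} → GStep h v w → P w → P v) where

      open ≡-Reasoning

      offset : V F → ℤ
      offset v = if does (P? v) then c + + 4 else c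

      offset-yes : ∀ {v} → P v → offset v ≡ c + + 4
      offset-yes {v} pv = cong (if_then c + + 4 else c) (dec-true (P? v) pv)

      offset-no : ∀ {v} → ¬ P v → offset v ≡ c
      offset-no {v} ¬pv = cong (if_then c + + 4 else c) (dec-false (P? v) ¬pv)

      offset-wellDef : ∀ {v w} → _≈V_ F v w → offset v ≡ offset w
      offset-wellDef {v} {w} v≈w with toSum (P? v) | toSum (P? w)
      ... | inj₁ pv  | inj₁ pw  = trans (offset-yes pv) (sym (offset-yes pw))
      ... | inj₂ ¬pv | inj₂ ¬pw = trans (offset-no ¬pv) (sym (offset-no ¬pw))
      ... | inj₁ pv  | inj₂ ¬pw = ⊥-elim (¬pw (closed (inj₁ (inj₂ (≈-sym v≈w) ◅ ε)) pv))
      ... | inj₂ ¬pv | inj₁ pw  = ⊥-elim (¬pv (closed (inj₁ (inj₂ v≈w ◅ ε)) pw))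

      k : V F → ℤ
      k v = h v + offset v

      k-increment : ∀ v w → k w - k v ≡ (h w - h v) + (offset w - offset v)
      k-increment v w = rearrange (h w) (offset w) (h v) (offset v)
        where
        rearrange : ∀ a b c d → (a + b) - (c + d) ≡ (a - c) + (b - d)
        rearrange = solve-∀

      k-increment-level : ∀ {v w d} → offset v ≡ d → offset w ≡ d → k w - k v ≡ h w - h v
      k-increment-level {v} {w} {d} ov≡d ow≡d = begin
        k w - k v                           ≡⟨ k-increment v w ⟩
        (h w - h v) + (offset w - offset v) ≡⟨ cong (_+_ (h w - h v)) (cong₂ _-_ ow≡d ov≡d) ⟩
        (h w - h v) + (d - d)               ≡⟨ cong (_+_ (h w - h v)) (ℤ.+-inverseʳ d) ⟩
        (h w - h v) + + 0                   ≡⟨ ℤ.+-identityʳ _ ⟩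
        h w - h v                           ∎

      k-increment-entering : ∀ {v w} → Arc F v w → ¬ P v → P w → k w - k v ≡ tt F eq (pt F v) (pt F w)
      k-increment-entering {v} {w} arc ¬pv pw with ¬GStep⇒slack arc (λ step → ¬pv (closed step pw))
      ... | low , interior = begin
        k w - k v                           ≡⟨ k-increment v w ⟩
        (h w - h v) + (offset w - offset v) ≡⟨ cong₂ (λ a b → a + (b - offset v)) low (offset-yes pw) ⟩
        bb′ + ((c + + 4) - offset v)        ≡⟨ cong (λ b → bb′ + ((c + + 4) - b)) (offset-no ¬pv) ⟩
        bb′ + ((c + + 4) - c)               ≡⟨ cong (_+_ bb′) (gain c) ⟩
        bb′ + + 4                           ≡⟨ interior⇒tt≡bb+4 interior ⟨
        tt F eq (pt F v) (pt F w)           ∎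
        where
        bb′ = bb F eq (pt F v) (pt F w)
        gain : ∀ c → (c + + 4) - c ≡ + 4
        gain = solve-∀

      k-increment-leaving : ∀ {v w} → Arc F v w → P v → ¬ P w → k w - k v ≡ bb F eq (pt F v) (pt F w)
      k-increment-leaving {v} {w} arc pv ¬pw with ¬GStep⇒slack (Arc-reverse arc) (λ step → ¬pw (closed step pv))
      ... | low , interior = begin
        k w - k v                           ≡⟨ k-increment v w ⟩
        (h w - h v) + (offset w - offset v) ≡⟨ cong₂ (λ a b → a + (b - offset v)) Dh≡tt (offset-no ¬pw) ⟩
        tt′ + (c - offset v)                ≡⟨ cong (λ b → tt′ + (c - b)) (offset-yes pv) ⟩
        tt′ + (c - (c + + 4))               ≡⟨ cong₂ _+_ tt≡bb+4 (loss c) ⟩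
        (bb′ + + 4) + - + 4                 ≡⟨ cancel bb′ ⟩
        bb′                                 ∎
        where
        tt′ = tt F eq (pt F v) (pt F w)
        bb′ = bb F eq (pt F v) (pt F w)
        negate : ∀ a b → b - a ≡ - (a - b)
        negate = solve-∀
        Dh≡tt : h w - h v ≡ tt′
        Dh≡tt = trans (negate (h v) (h w)) (trans (cong -_ low) (sym (tt≡-bb-reverse arc)))
        tt≡bb+4 : tt′ ≡ bb′ + + 4
        tt≡bb+4 = interior⇒tt≡bb+4 (trans (isBoundary-sym (pt F v) (pt F w)) interior)
        loss : ∀ c → c - (c + + 4) ≡ - + 4
        loss = solve-∀
        cancel : ∀ x → (x + + 4) + - + 4 ≡ x
        cancel = solve-∀

      k-arcs : ∀ v w → Arc F v w →
               (k w - k v ≡ bb F eq (pt F v) (pt F w)) ⊎ (k w - k v ≡ tt F eq (pt F v) (pt F w))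
      k-arcs v w arc with toSum (P? v) | toSum (P? w)
      ... | inj₁ pv  | inj₁ pw  = subst (λ d → (d ≡ _) ⊎ (d ≡ _))
                                        (sym (k-increment-level (offset-yes pv) (offset-yes pw)))
                                        (HeightFn.arcs hf v w arc)
      ... | inj₂ ¬pv | inj₂ ¬pw = subst (λ d → (d ≡ _) ⊎ (d ≡ _))
                                        (sym (k-increment-level (offset-no ¬pv) (offset-no ¬pw)))
                                        (HeightFn.arcs hf v w arc)
      ... | inj₂ ¬pv | inj₁ pw  = inj₂ (k-increment-entering arc ¬pv pw)
      ... | inj₁ pv  | inj₂ ¬pw = inj₁ (k-increment-leaving arc pv ¬pw)

      k-HeightFn : offset w₀ ≡ + 0 → HeightFn F eq w₀ k
      k-HeightFn offset-w₀ = record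
        { wellDef = λ v w v≈w → cong₂ _+_ (HeightFn.wellDef hf v w v≈w) (offset-wellDef v≈w)
        ; base    = cong₂ _+_ (HeightFn.base hf) offset-w₀
        ; arcs    = k-arcs
        }

    module _ (w₀-valid : Valid F w₀) where

      IsMax⇒paths-from : IsMax F eq w₀ h → ∀ u → Valid F u → GPath F eq h w₀ u
      IsMax⇒paths-from max u valid = decidable-stable (reach? u) λ ¬path →
        let offset≤0 = i+j≤i⇒j≤0 (h u) (offset u) (max _ raised u valid)
        in  +4≰0 (subst (_≤ + 0) (offset-yes ¬path) offset≤0)
        where
        reach? = GPath-from? h w₀-valid
        open Offset (¬? ∘ reach?) (+ 0) (λ step ¬path-w path-v → ¬path-w (path-v ◅◅ step ◅ ε))
        raised = k-HeightFn (offset-no (λ ¬path-w₀ → ¬path-w₀ ε))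
        +4≰0 : ¬ (+ 4 ≤ + 0)
        +4≰0 (+≤+ ())

      IsMin⇒paths-to : IsMin F eq w₀ h → ∀ u → Valid F u → GPath F eq h u w₀
      IsMin⇒paths-to min u valid = decidable-stable (reach? u) λ ¬path →
        let 0≤offset = i≤i+j⇒0≤j (h u) (offset u) (min _ lowered u valid)
        in  0≰-4 (subst (+ 0 ≤_) (offset-no ¬path) 0≤offset)
        where
        reach? = GPath-to? h w₀-valid
        open Offset reach? (- + 4) (λ step path-w → step ◅ path-w)
        lowered = k-HeightFn (offset-yes ε)
        0≰-4 : ¬ (+ 0 ≤ - + 4)
        0≰-4 ()

open HeightFunctions

mainTheorem10 : (F : List Cell) → IsFigure F →
    (eq : Point → Point → ℤ) → IsEquilibrium F eq →
    (w₀ : V F) → OnBoundaryHinf F w₀ →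
    (h : V F → ℤ) → HeightFn F eq w₀ h →
    (IsMax F eq w₀ h ⇔ (∀ u → Valid F u → GPath F eq h w₀ u))
    × (IsMin F eq w₀ h ⇔ (∀ u → Valid F u → GPath F eq h u w₀))
mainTheorem10 F _ eq isEq w₀ (w₀-valid , _) h hf =
  mk⇔ (IsMax⇒paths-from F eq isEq hf w₀-valid) (paths-from⇒IsMax F eq isEq hf) ,
  mk⇔ (IsMin⇒paths-to F eq isEq hf w₀-valid) (paths-to⇒IsMin F eq isEq hf)
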